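{- Let $\mathcal M\subset\mathbb Z^n$ be a minimal subgraph. Then $\deg_{\mathcal M}(x)\ge n$ for every $x\in\mathcal M$. Moreover, there are no adjacent $x,y\in\mathcal M$ with $\deg_{\mathcal M}(x)=\deg_{\mathcal M}(y)=n$.
   Context: $\mathbb Z^n$ is the integer lattice graph ($x\sim y$ iff $|x-y|=1$). For $\Omega\subset\mathbb Z^n$: $\tau\Omega=\{z\notin\Omega:\exists w\in\Omega,z\sim w\}$, $\overline\Omega=\Omega\cup\tau\Omega$, $E_\Omega$ = edges $\{x,y\}$ with $x\in\Omega,y\in\overline\Omega$, $\partial K$ = edges with exactly one endpoint in $K$. A proper nonempty $\mathcal M\subset\mathbb Z^n$ is minimal if for every finite $U$ and every $\hat K\subset\overline U$ with $\hat K\cap\tau U=\mathcal M\cap\tau U$, $|\partial\mathcal M\cap E_U|\le|\partial\hat K\cap E_U|$. $\deg_{\mathcal M}(x)$ is the number of neighbors of $x$ in $\mathcal M$. -}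

module Defs where

open import Data.Nat using (ℕ; _+_; _≤_)
open import Data.Integer using (ℤ) renaming (suc to sucℤ; pred to predℤ)
import Data.Integer.Properties as ℤP
open import Data.Fin using (Fin)
import Data.Fin.Properties as FinP
open import Data.Vec using (Vec; _[_]%=_)
import Data.Vec.Properties as VecP
open import Data.Bool using (Bool; true; false; _xor_; _∨_; if_then_else_)
open import Data.List using (List; []; _∷_; concatMap; allFin; deduplicate; filterᵇ; length; map)
open import Data.Nat.ListAction using (sum)
open import Data.List.Membership.Propositional using (_∈_)
open import Data.Product using (Σ; _×_; _,_; ∃; ∃-syntax; proj₁; proj₂)
import Data.Product.Properties as ProdP
open import Data.Sum using (_⊎_)
open import Relation.Nullary using (¬_)
open import Relation.Binary.PropositionalEquality using (_≡_)
open import Relation.Binary.Definitions using (DecidableEquality)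

Point : ℕ → Set
Point n = Vec ℤ n

_≟P_ : ∀ {n} → DecidableEquality (Point n)
_≟P_ = VecP.≡-dec ℤP._≟_

_+e_ : ∀ {n} → Point n → Fin n → Point n
x +e i = x [ i ]%= sucℤ

_-e_ : ∀ {n} → Point n → Fin n → Point n
x -e i = x [ i ]%= predℤ

_∼_ : ∀ {n} → Point n → Point n → Set
_∼_ {n} x y = Σ (Fin n) λ i → (y ≡ x +e i) ⊎ (y ≡ x -e i)

Subset : ℕ → Set
Subset n = Point n → Bool

FinSet : ℕ → Set
FinSet n = List (Point n)

τ : ∀ {n} → FinSet n → Point n → Set
τ U z = ¬ (z ∈ U) × ∃[ w ] (w ∈ U × (z ∼ w))

closure : ∀ {n} → FinSet n → Point n → Set
closure U z = (z ∈ U) ⊎ τ U z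

-- every edge of ℤⁿ is uniquely {x , x + eᵢ}; we represent it by (x , i)
Edge : ℕ → Set
Edge n = Point n × Fin n

_≟E_ : ∀ {n} → DecidableEquality (Edge n)
_≟E_ = ProdP.≡-dec _≟P_ FinP._≟_

-- E_U : edges {x,y} with x ∈ U and y ∈ Ū (i.e. edges with an endpoint in U),
-- listed without repetition
edgesU : ∀ {n} → FinSet n → List (Edge n)
edgesU {n} U = deduplicate _≟E_
  (concatMap (λ u → concatMap (λ i → (u , i) ∷ ((u -e i) , i) ∷ []) (allFin n)) U)

cut : ∀ {n} → Subset n → Edge n → Bool
cut K (x , i) = K x xor K (x +e i)

cutSize : ∀ {n} → Subset n → FinSet n → ℕ
cutSize K U = length (filterᵇ (cut K) (edgesU U))

Minimal : ∀ {n} → Subset n → Set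
Minimal {n} M =
  (∃[ x ] M x ≡ true) × (∃[ x ] M x ≡ false) ×
  ((U : FinSet n) (K : Subset n) →
     (∀ z → K z ≡ true → closure U z) →
     (∀ z → τ U z → K z ≡ M z) →
     cutSize M U ≤ cutSize K U)

b2n : Bool → ℕ
b2n true = 1
b2n false = 0

deg : ∀ {n} → Subset n → Point n → ℕ
deg {n} M x = sum (map (λ i → b2n (M (x +e i)) + b2n (M (x -e i))) (allFin n))

-- Removing the points of a finite U ⊆ M from a minimal M, keeping M only on τU,
-- gives an admissible competitor K. On the edges of E_U the set M is cut exactly
-- along the 2n − deg_M(u) edges at each u ∈ U that leave M, while K, which is
-- empty on U, is cut at most deg_K(u) ≤ deg_M(u) times at u. For U = {x} this
-- gives 2n − deg_M(x) ≤ deg_M(x). For U = {x, y} with x ∼ y the edge xy is not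
-- cut by M, so the cut edges of M at x and at y are distinct, and y ∉ K makes
-- deg_K(x) < deg_M(x); degrees n at both points would give 2n < 2n.
module Submission where

open import Defs

open import Data.Nat using (ℕ; suc; _≤_; _<_; _+_; z≤n; s≤s)
import Data.Nat.Properties as ℕP
open import Data.Nat.ListAction using (sum)
import Data.Integer.Properties as ℤP
open import Data.Fin using (Fin)
import Data.Fin.Properties as FinP
open import Data.Vec using (lookup)
import Data.Vec.Properties as VecP
open import Data.Bool using (Bool; true; false; T?)
open import Data.Bool.Properties using (T-≡)
open import Data.List using (List; []; _∷_; _++_; concatMap; allFin; deduplicate; filterᵇ; length; map)
import Data.List.Properties as ListP
open import Data.List.Membership.Propositional using (_∈_; find; lose)
import Data.List.Membership.Propositional.Properties as ∈P
import Data.List.Relation.Unary.Any as Any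
open import Data.List.Relation.Unary.Any using (here; there)
open import Data.List.Relation.Unary.All using (All; []; _∷_)
import Data.List.Relation.Unary.All as All
import Data.List.Relation.Unary.All.Properties as AllP
open import Data.List.Relation.Unary.AllPairs using ([]; _∷_)
import Data.List.Relation.Unary.AllPairs as AllPairs
import Data.List.Relation.Unary.AllPairs.Properties as AllPairsP
open import Data.List.Relation.Unary.Unique.Propositional using (Unique)
import Data.List.Relation.Unary.Unique.Propositional.Properties as UniqueP
open import Data.List.Relation.Binary.Disjoint.Propositional using (Disjoint)
open import Data.List.Relation.Binary.Sublist.Propositional using (_⊆_; _∷_; []; ⊆-trans)
import Data.List.Relation.Binary.Sublist.Propositional.Properties as SublistP
open import Data.Product using (_×_; _,_; ∃-syntax; proj₁; proj₂)
open import Data.Sum using (_⊎_; inj₁; inj₂)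
open import Data.Empty using (⊥; ⊥-elim)
open import Relation.Nullary using (¬_; Dec; yes; no)
open import Relation.Nullary.Decidable using (_⊎-dec_)
open import Relation.Binary.PropositionalEquality
  using (_≡_; _≢_; refl; sym; trans; cong; cong₂; subst; module ≡-Reasoning)
open import Relation.Binary.Definitions using (DecidableEquality)
open import Function using (_∘_; Equivalence)
open import Algebra.Properties.CommutativeSemigroup ℕP.+-commutativeSemigroup using () renaming (interchange to +-interchange)

private variable
  n : ℕ
  A : Set

sum-map-mono : (f g : A → ℕ) (xs : List A) → (∀ a → f a ≤ g a) → sum (map f xs) ≤ sum (map g xs)
sum-map-mono f g [] f≤g = z≤n
sum-map-mono f g (x ∷ xs) f≤g = ℕP.+-mono-≤ (f≤g x) (sum-map-mono f g xs f≤g)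

sum-map-< : (f g : A → ℕ) (xs : List A) {a : A} → a ∈ xs →
            (∀ a → f a ≤ g a) → f a < g a → sum (map f xs) < sum (map g xs)
sum-map-< f g (x ∷ xs) (here refl) f≤g fa<ga = ℕP.+-mono-<-≤ fa<ga (sum-map-mono f g xs f≤g)
sum-map-< f g (x ∷ xs) (there a∈xs) f≤g fa<ga = ℕP.+-mono-≤-< (f≤g x) (sum-map-< f g xs a∈xs f≤g fa<ga)

sum-map-+ : (f g : A → ℕ) (xs : List A) →
            sum (map f xs) + sum (map g xs) ≡ sum (map (λ a → f a + g a) xs)
sum-map-+ f g [] = refl
sum-map-+ f g (x ∷ xs) = trans (+-interchange (f x) _ (g x) _) (cong (f x + g x +_) (sum-map-+ f g xs))

sum-map-2 : (xs : List A) → sum (map (λ _ → 2) xs) ≡ length xs + length xs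
sum-map-2 [] = refl
sum-map-2 (x ∷ xs) = cong suc (trans (cong suc (sum-map-2 xs)) (sym (ℕP.+-suc (length xs) (length xs))))

count : (A → Bool) → List A → ℕ
count p xs = length (filterᵇ p xs)

count-∷ : (p : A → Bool) (a : A) (xs : List A) → count p (a ∷ xs) ≡ b2n (p a) + count p xs
count-∷ p a xs with p a
... | true = refl
... | false = refl

count-++ : (p : A → Bool) (xs ys : List A) → count p (xs ++ ys) ≡ count p xs + count p ys
count-++ p xs ys = trans (cong length (ListP.filter-++ (T? ∘ p) xs ys)) (ListP.length-++ (filterᵇ p xs))

count-concatMap : {B : Set} (p : A → Bool) (f : B → List A) (xs : List B) →
                  count p (concatMap f xs) ≡ sum (map (count p ∘ f) xs)
count-concatMap p f [] = refl
count-concatMap p f (x ∷ xs) =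
  trans (count-++ p (f x) (concatMap f xs)) (cong (count p (f x) +_) (count-concatMap p f xs))

Unique-⊆⇒length-≤ : {xs ys : List A} → Unique xs → (∀ {a} → a ∈ xs → a ∈ ys) → length xs ≤ length ys
Unique-⊆⇒length-≤ {xs = []} _ _ = z≤n
Unique-⊆⇒length-≤ {xs = x ∷ xs} (x∉xs ∷ xs!) xs⊆ys with ∈P.∈-∃++ (xs⊆ys (here refl))
... | ys₁ , ys₂ , refl = begin
  suc (length xs)                ≤⟨ s≤s (Unique-⊆⇒length-≤ xs! xs⊆ys₁++ys₂) ⟩
  suc (length (ys₁ ++ ys₂))      ≡⟨ cong suc (ListP.length-++ ys₁) ⟩
  suc (length ys₁ + length ys₂)  ≡⟨ sym (ℕP.+-suc (length ys₁) (length ys₂)) ⟩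
  length ys₁ + suc (length ys₂)  ≡⟨ sym (ListP.length-++ ys₁) ⟩
  length (ys₁ ++ x ∷ ys₂)        ∎
  where
  open ℕP.≤-Reasoning
  xs⊆ys₁++ys₂ : ∀ {a} → a ∈ xs → a ∈ ys₁ ++ ys₂
  xs⊆ys₁++ys₂ a∈xs with ∈P.∈-++⁻ ys₁ (xs⊆ys (there a∈xs))
  ... | inj₁ a∈ys₁ = ∈P.∈-++⁺ˡ a∈ys₁
  ... | inj₂ (here refl) = ⊥-elim (All.lookup x∉xs a∈xs refl)
  ... | inj₂ (there a∈ys₂) = ∈P.∈-++⁺ʳ ys₁ a∈ys₂

deduplicate-⊆ : (_≟_ : DecidableEquality A) (xs : List A) → deduplicate _≟_ xs ⊆ xs
deduplicate-⊆ _≟_ [] = []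
deduplicate-⊆ _≟_ (x ∷ xs) = refl ∷ ⊆-trans (SublistP.filter-⊆ _ (deduplicate _≟_ xs)) (deduplicate-⊆ _≟_ xs)

count-deduplicate-≤ : (_≟_ : DecidableEquality A) (p : A → Bool) (xs : List A) →
                      count p (deduplicate _≟_ xs) ≤ count p xs
count-deduplicate-≤ _≟_ p xs =
  SublistP.length-mono-≤ (SublistP.filter⁺ (T? ∘ p) (T? ∘ p) (λ { refl pa → pa }) (deduplicate-⊆ _≟_ xs))

+e-−e : (x : Point n) (i : Fin n) → (x +e i) -e i ≡ x
+e-−e x i = trans (VecP.updateAt-updateAt i x) (VecP.updateAt-id-local i x (ℤP.pred-suc _))

−e-+e : (x : Point n) (i : Fin n) → (x -e i) +e i ≡ x
−e-+e x i = trans (VecP.updateAt-updateAt i x) (VecP.updateAt-id-local i x (ℤP.suc-pred _))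

+e-≢ : (x : Point n) (i : Fin n) → x +e i ≢ x
+e-≢ x i eq = ℤP.i≢suc[i] (sym (trans (sym (VecP.lookup∘updateAt i x)) (cong (λ v → lookup v i) eq)))

−e-≢ : (x : Point n) (i : Fin n) → x -e i ≢ x
−e-≢ x i eq = +e-≢ x i (trans (sym (cong (_+e i) eq)) (−e-+e x i))

∼-sym : {x y : Point n} → x ∼ y → y ∼ x
∼-sym {x = x} (i , inj₁ refl) = i , inj₂ (sym (+e-−e x i))
∼-sym {x = x} (i , inj₂ refl) = i , inj₁ (sym (−e-+e x i))

∼⇒≢ : {x y : Point n} → x ∼ y → x ≢ y
∼⇒≢ {x = x} (i , inj₁ refl) eq = +e-≢ x i (sym eq)
∼⇒≢ {x = x} (i , inj₂ refl) eq = −e-≢ x i (sym eq)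

_∼?_ : (x y : Point n) → Dec (x ∼ y)
x ∼? y = FinP.any? (λ i → (y ≟P (x +e i)) ⊎-dec (y ≟P (x -e i)))

source target : Edge n → Point n
source (x , i) = x
target (x , i) = x +e i

cut-endpoints : (K : Subset n) (e : Edge n) → cut K e ≡ true →
                K (source e) ≡ true → K (target e) ≡ true → ⊥
cut-endpoints K (x , i) c Kx Kx+ rewrite Kx | Kx+ with c
... | ()

axisEdges : Point n → Fin n → List (Edge n)
axisEdges x i = (x , i) ∷ (x -e i , i) ∷ []

-- The 2n edges at x, listed exactly as in edgesU, so that edgesU U is definitionally
-- deduplicate _≟E_ (concatMap star U).
star : Point n → List (Edge n)
star {n} x = concatMap (axisEdges x) (allFin n)

∈-star⁻ : (x : Point n) {e : Edge n} → e ∈ star x → x ≡ source e ⊎ x ≡ target e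
∈-star⁻ x m with find (∈P.∈-concatMap⁻ (axisEdges x) {xs = allFin _} m)
... | i , _ , here refl = inj₁ refl
... | i , _ , there (here refl) = inj₂ (sym (−e-+e x i))

star-unique : (x : Point n) → Unique (star x)
star-unique {n} x = UniqueP.concat⁺ (AllP.map⁺ (All.tabulate λ _ → axisEdges-unique))
  (AllPairsP.map⁺ (AllPairs.map axisEdges-disjoint (UniqueP.allFin⁺ n)))
  where
  axisEdges-unique : {i : Fin n} → Unique (axisEdges x i)
  axisEdges-unique {i} = ((λ eq → −e-≢ x i (sym (cong proj₁ eq))) ∷ []) ∷ [] ∷ []
  direction : ∀ {i e} → e ∈ axisEdges x i → proj₂ e ≡ i
  direction (here refl) = refl
  direction (there (here refl)) = refl
  axisEdges-disjoint : {i j : Fin n} → i ≢ j → Disjoint (axisEdges x i) (axisEdges x j)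
  axisEdges-disjoint i≢j (mi , mj) = i≢j (trans (sym (direction mi)) (direction mj))

count-star : (p : Edge n → Bool) (x : Point n) →
             count p (star x) ≡ sum (map (λ i → b2n (p (x , i)) + b2n (p (x -e i , i))) (allFin n))
count-star {n} p x = trans (count-concatMap p (axisEdges x) (allFin n))
  (cong sum (ListP.map-cong count-axisEdges (allFin n)))
  where
  count-axisEdges : ∀ i → count p (axisEdges x i) ≡ b2n (p (x , i)) + b2n (p (x -e i , i))
  count-axisEdges i = trans (count-∷ p _ _)
    (cong (b2n (p (x , i)) +_) (trans (count-∷ p _ []) (ℕP.+-identityʳ _)))

count-cut-star-outside : (K : Subset n) (x : Point n) → K x ≡ false →
                         count (cut K) (star x) ≡ deg K x
count-cut-star-outside {n} K x Kx =
  trans (count-star (cut K) x) (cong sum (ListP.map-cong per-axis (allFin n)))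
  where
  per-axis : ∀ i → b2n (cut K (x , i)) + b2n (cut K (x -e i , i)) ≡ b2n (K (x +e i)) + b2n (K (x -e i))
  per-axis i rewrite −e-+e x i | Kx with K (x -e i)
  ... | true = refl
  ... | false = refl

-- Stated with deg on the left-hand side to avoid truncated subtraction 2n ∸ deg.
count-cut-star-inside : (K : Subset n) (x : Point n) → K x ≡ true →
                        count (cut K) (star x) + deg K x ≡ n + n
count-cut-star-inside {n} K x Kx = begin
  count (cut K) (star x) + deg K x                          ≡⟨ cong (_+ deg K x) (count-star (cut K) x) ⟩
  sum (map cutAt (allFin n)) + sum (map degAt (allFin n))   ≡⟨ sum-map-+ cutAt degAt (allFin n) ⟩
  sum (map (λ i → cutAt i + degAt i) (allFin n))           ≡⟨ cong sum (ListP.map-cong per-axis (allFin n)) ⟩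
  sum (map (λ _ → 2) (allFin n))                            ≡⟨ sum-map-2 (allFin n) ⟩
  length (allFin n) + length (allFin n)                     ≡⟨ cong₂ _+_ length-allFin length-allFin ⟩
  n + n                                                     ∎
  where
  open ≡-Reasoning
  length-allFin : length (allFin n) ≡ n
  length-allFin = ListP.length-tabulate (λ i → i)
  cutAt degAt : Fin n → ℕ
  cutAt i = b2n (cut K (x , i)) + b2n (cut K (x -e i , i))
  degAt i = b2n (K (x +e i)) + b2n (K (x -e i))
  per-axis : ∀ i → cutAt i + degAt i ≡ 2
  per-axis i rewrite −e-+e x i | Kx with K (x +e i) | K (x -e i)
  ... | true  | true  = refl
  ... | true  | false = refl
  ... | false | true  = refl
  ... | false | false = refl

_⊆ᴮ_ : Subset n → Subset n → Set
K ⊆ᴮ M = ∀ z → b2n (K z) ≤ b2n (M z)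

deg-mono : (K M : Subset n) (x : Point n) → K ⊆ᴮ M → deg K x ≤ deg M x
deg-mono {n} K M x K⊆M = sum-map-mono _ _ (allFin n) (λ i → ℕP.+-mono-≤ (K⊆M _) (K⊆M _))

deg-mono-< : (K M : Subset n) {x y : Point n} → K ⊆ᴮ M → x ∼ y →
             K y ≡ false → M y ≡ true → deg K x < deg M x
deg-mono-< {n} K M {y = y} K⊆M (i , y≡) Ky My =
  sum-map-< _ _ (allFin n) (∈P.∈-allFin i) (λ _ → ℕP.+-mono-≤ (K⊆M _) (K⊆M _)) (strict y≡)
  where
  Ky<My : b2n (K y) < b2n (M y)
  Ky<My rewrite Ky | My = s≤s z≤n
  strict : ∀ {x} → y ≡ x +e i ⊎ y ≡ x -e i →
           b2n (K (x +e i)) + b2n (K (x -e i)) < b2n (M (x +e i)) + b2n (M (x -e i))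
  strict (inj₁ refl) = ℕP.+-mono-<-≤ Ky<My (K⊆M _)
  strict (inj₂ refl) = ℕP.+-mono-≤-< (K⊆M _) Ky<My

excise : Subset n → FinSet n → Subset n
excise M U z with Any.any? (z ≟P_) U | Any.any? (_∼? z) U
... | yes _ | _     = false
... | no _  | yes _ = M z
... | no _  | no _  = false

excise-⊆-closure : (M : Subset n) (U : FinSet n) (z : Point n) → excise M U z ≡ true → closure U z
excise-⊆-closure M U z eq with Any.any? (z ≟P_) U | Any.any? (_∼? z) U
... | no z∉U | yes adj with find adj
...   | w , w∈U , w∼z = inj₂ (z∉U , w , w∈U , ∼-sym w∼z)

excise-τ : (M : Subset n) (U : FinSet n) (z : Point n) → τ U z → excise M U z ≡ M z
excise-τ M U z (z∉U , w , w∈U , z∼w) with Any.any? (z ≟P_) U | Any.any? (_∼? z) U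
... | yes z∈U | _      = ⊥-elim (z∉U z∈U)
... | no _    | yes _  = refl
... | no _    | no ¬adj = ⊥-elim (¬adj (lose w∈U (∼-sym z∼w)))

excise-∈ : (M : Subset n) (U : FinSet n) {z : Point n} → z ∈ U → excise M U z ≡ false
excise-∈ M U {z} z∈U with Any.any? (z ≟P_) U | Any.any? (_∼? z) U
... | yes _   | _ = refl
... | no z∉U  | _ = ⊥-elim (z∉U z∈U)

excise-⊆ : (M : Subset n) (U : FinSet n) → excise M U ⊆ᴮ M
excise-⊆ M U z with Any.any? (z ≟P_) U | Any.any? (_∼? z) U
... | yes _ | _     = z≤n
... | no _  | yes _ = ℕP.≤-refl
... | no _  | no _  = z≤n

cutSize-≤-Σdeg : (K : Subset n) (U : FinSet n) → All (λ u → K u ≡ false) U →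
                 cutSize K U ≤ sum (map (deg K) U)
cutSize-≤-Σdeg K U K[U]≡false = begin
  cutSize K U                         ≤⟨ count-deduplicate-≤ _≟E_ (cut K) (concatMap star U) ⟩
  count (cut K) (concatMap star U)    ≡⟨ count-concatMap (cut K) star U ⟩
  sum (map (count (cut K) ∘ star) U)  ≡⟨ cong sum (ListP.map-cong-local (All.map (count-cut-star-outside K _) K[U]≡false)) ⟩
  sum (map (deg K) U)                 ∎
  where open ℕP.≤-Reasoning

length-≤-cutSize : (K : Subset n) (U : FinSet n) {S : List (Edge n)} → Unique S →
                   (∀ {e} → e ∈ S → e ∈ concatMap star U × cut K e ≡ true) → length S ≤ cutSize K U
length-≤-cutSize K U S! S⊆ = Unique-⊆⇒length-≤ S! λ e∈S →
  ∈P.∈-filter⁺ (T? ∘ cut K) (∈P.∈-deduplicate⁺ _≟E_ (proj₁ (S⊆ e∈S))) (Equivalence.from T-≡ (proj₂ (S⊆ e∈S)))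

minimal⇒cutEdges≤Σdeg-excise : (M : Subset n) → Minimal M → (U : FinSet n) {S : List (Edge n)} → Unique S →
  (∀ {e} → e ∈ S → e ∈ concatMap star U × cut M e ≡ true) →
  length S ≤ sum (map (deg (excise M U)) U)
minimal⇒cutEdges≤Σdeg-excise M (_ , _ , minimal) U {S} S! S⊆ = begin
  length S          ≤⟨ length-≤-cutSize M U S! S⊆ ⟩
  cutSize M U       ≤⟨ minimal U K (excise-⊆-closure M U) (excise-τ M U) ⟩
  cutSize K U       ≤⟨ cutSize-≤-Σdeg K U (All.tabulate (excise-∈ M U)) ⟩
  sum (map (deg K) U) ∎
  where
  open ℕP.≤-Reasoning
  K = excise M U

cutStar : Subset n → Point n → List (Edge n)
cutStar M x = filterᵇ (cut M) (star x)

cutStar-unique : (M : Subset n) (x : Point n) → Unique (cutStar M x)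
cutStar-unique M x = UniqueP.filter⁺ (T? ∘ cut M) (star-unique x)

∈-cutStar⁻ : (M : Subset n) (x : Point n) {e : Edge n} → e ∈ cutStar M x → e ∈ star x × cut M e ≡ true
∈-cutStar⁻ M x e∈ with ∈P.∈-filter⁻ (T? ∘ cut M) e∈
... | e∈star , cut-e = e∈star , Equivalence.to T-≡ cut-e

-- Two stars share at most the edge xy, and that edge is not cut since both ends lie in M.
cutStar-disjoint : (M : Subset n) {x y : Point n} → M x ≡ true → M y ≡ true → x ∼ y →
                   Disjoint (cutStar M x) (cutStar M y)
cutStar-disjoint M {x} {y} Mx My x∼y (e∈x , e∈y)
  with ∈-cutStar⁻ M x e∈x | ∈-cutStar⁻ M y e∈y
... | e∈star-x , cut-e | e∈star-y , _ with ∈-star⁻ x e∈star-x | ∈-star⁻ y e∈star-y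
... | inj₁ refl | inj₁ y≡ = ∼⇒≢ x∼y (sym y≡)
... | inj₂ refl | inj₂ y≡ = ∼⇒≢ x∼y (sym y≡)
... | inj₁ refl | inj₂ refl = cut-endpoints M _ cut-e Mx My
... | inj₂ refl | inj₁ refl = cut-endpoints M _ cut-e My Mx

+-double-cancel-≤ : ∀ {m k} → m + m ≤ k + k → m ≤ k
+-double-cancel-≤ m+m≤k+k = ℕP.≮⇒≥ λ k<m → ℕP.<⇒≱ (ℕP.+-mono-< k<m k<m) m+m≤k+k

minimal⇒n≤deg : (M : Subset n) → Minimal M → ∀ x → M x ≡ true → n ≤ deg M x
minimal⇒n≤deg {n} M minM x Mx = +-double-cancel-≤ (begin
  n + n                                  ≡⟨ sym (count-cut-star-inside M x Mx) ⟩
  length (cutStar M x) + deg M x         ≤⟨ ℕP.+-monoˡ-≤ (deg M x) cutStar≤deg ⟩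
  deg M x + deg M x                      ∎)
  where
  open ℕP.≤-Reasoning
  cutStar≤deg : length (cutStar M x) ≤ deg M x
  cutStar≤deg = begin
    length (cutStar M x)   ≤⟨ minimal⇒cutEdges≤Σdeg-excise M minM (x ∷ []) (cutStar-unique M x)
                                (λ e∈ → ∈P.∈-++⁺ˡ (proj₁ (∈-cutStar⁻ M x e∈)) , proj₂ (∈-cutStar⁻ M x e∈)) ⟩
    deg (excise M (x ∷ [])) x + 0  ≡⟨ ℕP.+-identityʳ _ ⟩
    deg (excise M (x ∷ [])) x      ≤⟨ deg-mono _ M x (excise-⊆ M (x ∷ [])) ⟩
    deg M x                ∎

minimal⇒¬adjacent-deg-n : (M : Subset n) → Minimal M → {x y : Point n} →
  M x ≡ true → M y ≡ true → x ∼ y → deg M x ≡ n → deg M y ≡ n → ⊥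
minimal⇒¬adjacent-deg-n {n} M minM {x} {y} Mx My x∼y deg-x deg-y = ℕP.<-irrefl refl (begin-strict
  n + n                                          ≡⟨ sym (cong₂ _+_ (length-cutStar Mx deg-x) (length-cutStar My deg-y)) ⟩
  length (cutStar M x) + length (cutStar M y)    ≡⟨ sym (ListP.length-++ (cutStar M x)) ⟩
  length (cutStar M x ++ cutStar M y)            ≤⟨ minimal⇒cutEdges≤Σdeg-excise M minM U S! S⊆ ⟩
  deg K x + (deg K y + 0)                        ≡⟨ cong (deg K x +_) (ℕP.+-identityʳ _) ⟩
  deg K x + deg K y                              <⟨ ℕP.+-mono-< (degK< x∼y (there (here refl)) My deg-x) (degK< (∼-sym x∼y) (here refl) Mx deg-y) ⟩
  n + n                                          ∎)
  where
  open ℕP.≤-Reasoning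
  U = x ∷ y ∷ []
  K = excise M U
  length-cutStar : ∀ {z} → M z ≡ true → deg M z ≡ n → length (cutStar M z) ≡ n
  length-cutStar {z} Mz deg-z =
    ℕP.+-cancelʳ-≡ n _ _ (subst (λ d → length (cutStar M z) + d ≡ n + n) deg-z (count-cut-star-inside M z Mz))
  S! : Unique (cutStar M x ++ cutStar M y)
  S! = UniqueP.++⁺ (cutStar-unique M x) (cutStar-unique M y) (cutStar-disjoint M Mx My x∼y)
  S⊆ : ∀ {e} → e ∈ cutStar M x ++ cutStar M y → e ∈ star x ++ (star y ++ []) × cut M e ≡ true
  S⊆ e∈ with ∈P.∈-++⁻ (cutStar M x) e∈
  ... | inj₁ e∈x = ∈P.∈-++⁺ˡ (proj₁ (∈-cutStar⁻ M x e∈x)) , proj₂ (∈-cutStar⁻ M x e∈x)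
  ... | inj₂ e∈y = ∈P.∈-++⁺ʳ (star x) (∈P.∈-++⁺ˡ (proj₁ (∈-cutStar⁻ M y e∈y))) , proj₂ (∈-cutStar⁻ M y e∈y)
  degK< : ∀ {z w} → z ∼ w → w ∈ U → M w ≡ true → deg M z ≡ n → deg K z < n
  degK< {z} z∼w w∈U Mw deg-z =
    subst (deg K z <_) deg-z (deg-mono-< K M (excise-⊆ M U) z∼w (excise-∈ M U w∈U) Mw)

lemma4p2 : ∀ n (M : Subset n) → Minimal M →
    (∀ x → M x ≡ true → n ≤ deg M x) ×
    ¬ (∃[ x ] ∃[ y ] (M x ≡ true × M y ≡ true × x ∼ y × deg M x ≡ n × deg M y ≡ n))
lemma4p2 n M minM =
  minimal⇒n≤deg M minM ,
  λ (x , y , Mx , My , x∼y , deg-x , deg-y) → minimal⇒¬adjacent-deg-n M minM Mx My x∼y deg-x deg-y
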